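{- Let $O=(0,0,0)$. The set of all equilateral triangles with vertices in $\mathbb{Z}^3$, one vertex equal to $O$ and the other two lying in the plane $\{(\alpha,\beta,\gamma):\alpha+11\beta+11\gamma=0\}$ equals $$\{\,\{O,(11m-11n,\,4m+5n,\,-5m-4n),\,(-11n,\,9m-4n,\,-9m+5n)\} : m,n\in\mathbb{Z},\ (m,n)\neq(0,0)\,\},$$ and the triangle corresponding to $(m,n)$ has side length $9\sqrt{2(m^2-mn+n^2)}$.
   Context: Triangles are regarded as unordered sets of three vertices. -}

module Defs where

open import Data.Integer using (ℤ; +_; _+_; _-_; _*_; -_)
open import Data.Product using (_×_; _,_)
open import Data.Sum using (_⊎_)
open import Relation.Binary.PropositionalEquality using (_≡_)
open import Relation.Nullary using (¬_)
open import Function.Bundles using (_⇔_)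

Point : Set
Point = ℤ × ℤ × ℤ

O : Point
O = (+ 0 , + 0 , + 0)

dist² : Point → Point → ℤ
dist² (a₁ , a₂ , a₃) (b₁ , b₂ , b₃) =
  (a₁ - b₁) * (a₁ - b₁) + (a₂ - b₂) * (a₂ - b₂) + (a₃ - b₃) * (a₃ - b₃)

InPlane : Point → Set
InPlane (α , β , γ) = α + + 11 * β + + 11 * γ ≡ + 0

-- A triangle is given by a triple of vertices; it is regarded as the
-- unordered set of its vertices (see SameTriangle).
Triangle : Set
Triangle = Point × Point × Point

_∈T_ : Point → Triangle → Set
x ∈T (a , b , c) = x ≡ a ⊎ x ≡ b ⊎ x ≡ c

SameTriangle : Triangle → Triangle → Set
SameTriangle T T' = ∀ x → (x ∈T T) ⇔ (x ∈T T')

Equilateral : Triangle → Set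
Equilateral (a , b , c) =
  ¬ a ≡ b × ¬ b ≡ c × ¬ a ≡ c ×
  dist² a b ≡ dist² b c × dist² b c ≡ dist² a c

Admissible : Triangle → Set
Admissible T = Equilateral T × O ∈T T × (∀ x → x ∈T T → ¬ x ≡ O → InPlane x)

vA : ℤ → ℤ → Point
vA m n = (+ 11 * m - + 11 * n , + 4 * m + + 5 * n , - (+ 5 * m) - + 4 * n)

vB : ℤ → ℤ → Point
vB m n = (- (+ 11 * n) , + 9 * m - + 4 * n , - (+ 9 * m) + + 5 * n)

paramTriangle : ℤ → ℤ → Triangle
paramTriangle m n = (O , vA m n , vB m n)

{-# OPTIONS --safe #-}
-- If O, u, v is equilateral then v is u rotated by ±60° about the normal N = (1, 11, 11),
-- and since |N| = 9√3 this reads 18 v = 9 u ± N × u.  In integers: the product of the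
-- hexagonal norms of the two rotation defects is, up to the factor 8, the sum of the squared
-- differences of the three squared side lengths (turn-identity), so one defect vanishes.  Its
-- vanishing is a pair of linear equations saying that (u, v) or (v, u) is (vA m n, vB m n) for
-- m, n read off from the coordinates.  Conversely every side of paramTriangle m n has squared
-- length 162 (m² − mn + n²), and m² − mn + n² = 0 only for m = n = 0.
module Submission where

open import Defs
open import Data.Integer using (ℤ; +_; _+_; _-_; _*_; -_; 0ℤ; ∣_∣; +[1+_]; -[1+_])
open import Data.Integer.Properties
  using (+-identityˡ; +-identityʳ; +-inverseʳ; +-injective; ∣i∣≡0⇒i≡0; *-cancelˡ-≡; i*j≡0⇒i≡0∨j≡0)
open import Data.Integer.Tactic.RingSolver using (solve-∀; solve)
import Data.Nat as ℕ
import Data.Nat.Properties as ℕ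
open import Data.List using (List; _∷_; [])
open import Data.Product using (_×_; _,_; ∃₂; proj₁; proj₂; swap)
open import Data.Sum using (_⊎_; inj₁; inj₂; [_,_]′)
import Data.Sum as Sum
open import Data.Empty using (⊥; ⊥-elim)
open import Function using (id; _∘_)
open import Function.Bundles using (_⇔_; mk⇔; Equivalence)
import Function.Properties.Equivalence as ⇔
open import Relation.Binary.PropositionalEquality
  using (_≡_; refl; sym; trans; cong; cong₂; subst; subst₂; module ≡-Reasoning)
open import Relation.Nullary using (¬_)

open ≡-Reasoning

i*i≡+∣i∣*∣i∣ : ∀ i → i * i ≡ + (∣ i ∣ ℕ.* ∣ i ∣)
i*i≡+∣i∣*∣i∣ (+ 0)    = refl
i*i≡+∣i∣*∣i∣ +[1+ n ] = refl
i*i≡+∣i∣*∣i∣ -[1+ n ] = refl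

sum-of-squares≡0 : ∀ x y z → x * x + y * y + z * z ≡ 0ℤ → x ≡ 0ℤ × y ≡ 0ℤ × z ≡ 0ℤ
sum-of-squares≡0 x y z eq =
  root x (ℕ.m+n≡0⇒m≡0 X (ℕ.m+n≡0⇒m≡0 (X ℕ.+ Y) sum≡0)) ,
  root y (ℕ.m+n≡0⇒n≡0 X (ℕ.m+n≡0⇒m≡0 (X ℕ.+ Y) sum≡0)) ,
  root z (ℕ.m+n≡0⇒n≡0 (X ℕ.+ Y) sum≡0)
  where
  X Y Z : ℕ.ℕ
  X = ∣ x ∣ ℕ.* ∣ x ∣
  Y = ∣ y ∣ ℕ.* ∣ y ∣
  Z = ∣ z ∣ ℕ.* ∣ z ∣
  sum≡0 : X ℕ.+ Y ℕ.+ Z ≡ 0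
  sum≡0 = +-injective (begin
    + X + + Y + + Z
      ≡⟨ sym (cong₂ _+_ (cong₂ _+_ (i*i≡+∣i∣*∣i∣ x) (i*i≡+∣i∣*∣i∣ y)) (i*i≡+∣i∣*∣i∣ z)) ⟩
    x * x + y * y + z * z
      ≡⟨ eq ⟩
    + 0 ∎)
  root : ∀ i → ∣ i ∣ ℕ.* ∣ i ∣ ≡ 0 → i ≡ 0ℤ
  root i eq = ∣i∣≡0⇒i≡0 ([ id , id ]′ (ℕ.m*n≡0⇒m≡0∨n≡0 ∣ i ∣ eq))

-- The INLINE pragmas below make these abbreviations transparent to the ring solver.

hexNorm : ℤ → ℤ → ℤ
hexNorm m n = m * m - m * n + n * n
{-# INLINE hexNorm #-}

hexNorm≡0⇒≡0 : ∀ m n → hexNorm m n ≡ 0ℤ → m ≡ 0ℤ × n ≡ 0ℤ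
hexNorm≡0⇒≡0 m n eq with sum-of-squares≡0 m n (m - n) (begin
    m * m + n * n + (m - n) * (m - n) ≡⟨ solve (m ∷ n ∷ []) ⟩
    + 2 * hexNorm m n                 ≡⟨ cong (+ 2 *_) eq ⟩
    0ℤ                                ∎)
... | m≡0 , n≡0 , _ = m≡0 , n≡0

dist²-sym : ∀ p q → dist² p q ≡ dist² q p
dist²-sym (a₁ , a₂ , a₃) (b₁ , b₂ , b₃) =
  cong₂ _+_ (cong₂ _+_ (square-sub a₁ b₁) (square-sub a₂ b₂)) (square-sub a₃ b₃)
  where
  square-sub : ∀ a b → (a - b) * (a - b) ≡ (b - a) * (b - a)
  square-sub = solve-∀

dist²-self : ∀ p → dist² p p ≡ 0ℤ
dist²-self (a₁ , a₂ , a₃) rewrite +-inverseʳ a₁ | +-inverseʳ a₂ | +-inverseʳ a₃ = refl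

dist²≢0⇒≢ : ∀ {p q} → ¬ dist² p q ≡ 0ℤ → ¬ p ≡ q
dist²≢0⇒≢ {p} d≢0 refl = d≢0 (dist²-self p)

∈T-swap₁₂ : ∀ {x a b c} → x ∈T (a , b , c) → x ∈T (b , a , c)
∈T-swap₁₂ (inj₁ x≡a)         = inj₂ (inj₁ x≡a)
∈T-swap₁₂ (inj₂ (inj₁ x≡b))  = inj₁ x≡b
∈T-swap₁₂ (inj₂ (inj₂ x≡c))  = inj₂ (inj₂ x≡c)

∈T-swap₂₃ : ∀ {x a b c} → x ∈T (a , b , c) → x ∈T (a , c , b)
∈T-swap₂₃ (inj₁ x≡a)         = inj₁ x≡a
∈T-swap₂₃ (inj₂ (inj₁ x≡b))  = inj₂ (inj₂ x≡b)
∈T-swap₂₃ (inj₂ (inj₂ x≡c))  = inj₂ (inj₁ x≡c)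

SameTriangle-refl : ∀ {T} → SameTriangle T T
SameTriangle-refl x = ⇔.refl

SameTriangle-sym : ∀ {T T′} → SameTriangle T T′ → SameTriangle T′ T
SameTriangle-sym T∼T′ x = ⇔.sym (T∼T′ x)

SameTriangle-trans : ∀ {T T′ T″} → SameTriangle T T′ → SameTriangle T′ T″ → SameTriangle T T″
SameTriangle-trans T∼T′ T′∼T″ x = ⇔.trans (T∼T′ x) (T′∼T″ x)

SameTriangle-swap₁₂ : ∀ {a b c} → SameTriangle (a , b , c) (b , a , c)
SameTriangle-swap₁₂ x = mk⇔ ∈T-swap₁₂ ∈T-swap₁₂

SameTriangle-swap₂₃ : ∀ {a b c} → SameTriangle (a , b , c) (a , c , b)
SameTriangle-swap₂₃ x = mk⇔ ∈T-swap₂₃ ∈T-swap₂₃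

∈T⇒first : ∀ {x T} → x ∈T T → ∃₂ λ u v → SameTriangle T (x , u , v)
∈T⇒first {T = a , b , c} (inj₁ refl)         = b , c , SameTriangle-refl
∈T⇒first {T = a , b , c} (inj₂ (inj₁ refl))  = a , c , SameTriangle-swap₁₂
∈T⇒first {T = a , b , c} (inj₂ (inj₂ refl))  = a , b , SameTriangle-trans SameTriangle-swap₂₃ SameTriangle-swap₁₂

merge₁₂ : ∀ {x a b c} → a ≡ b → x ∈T (a , b , c) → x ≡ a ⊎ x ≡ c
merge₁₂ refl (inj₁ x≡a)         = inj₁ x≡a
merge₁₂ refl (inj₂ (inj₁ x≡b))  = inj₁ x≡b
merge₁₂ refl (inj₂ (inj₂ x≡c))  = inj₂ x≡c

merge₂₃ : ∀ {x a b c} → b ≡ c → x ∈T (a , b , c) → x ≡ a ⊎ x ≡ b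
merge₂₃ refl (inj₁ x≡a)         = inj₁ x≡a
merge₂₃ refl (inj₂ (inj₁ x≡b))  = inj₂ x≡b
merge₂₃ refl (inj₂ (inj₂ x≡c))  = inj₂ x≡c

merge₁₃ : ∀ {x a b c} → a ≡ c → x ∈T (a , b , c) → x ≡ a ⊎ x ≡ b
merge₁₃ refl (inj₁ x≡a)         = inj₁ x≡a
merge₁₃ refl (inj₂ (inj₁ x≡b))  = inj₂ x≡b
merge₁₃ refl (inj₂ (inj₂ x≡c))  = inj₁ x≡c

pigeonhole : ∀ {a b c p q : Point} → ¬ a ≡ b → ¬ b ≡ c → ¬ a ≡ c →
  (∀ {x} → x ∈T (a , b , c) → x ≡ p ⊎ x ≡ q) → ⊥
pigeonhole a≢b b≢c a≢c into
  with into (inj₁ refl) | into (inj₂ (inj₁ refl)) | into (inj₂ (inj₂ refl))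
... | inj₁ a≡p | inj₁ b≡p | _        = a≢b (trans a≡p (sym b≡p))
... | inj₂ a≡q | inj₂ b≡q | _        = a≢b (trans a≡q (sym b≡q))
... | inj₁ a≡p | inj₂ _   | inj₁ c≡p = a≢c (trans a≡p (sym c≡p))
... | inj₁ _   | inj₂ b≡q | inj₂ c≡q = b≢c (trans b≡q (sym c≡q))
... | inj₂ _   | inj₁ b≡p | inj₁ c≡p = b≢c (trans b≡p (sym c≡p))
... | inj₂ a≡q | inj₁ _   | inj₂ c≡q = a≢c (trans a≡q (sym c≡q))

Equilateral-resp : ∀ {T T′} → SameTriangle T T′ → Equilateral T′ → Equilateral T
Equilateral-resp {a , b , c} {a′ , b′ , c′} T∼T′ (a′≢b′ , b′≢c′ , a′≢c′ , a′b′≡b′c′ , b′c′≡a′c′) =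
  a≢b , b≢c , a≢c ,
  trans (side (to a∈T) (to b∈T) a≢b) (sym (side (to b∈T) (to c∈T) b≢c)) ,
  trans (side (to b∈T) (to c∈T) b≢c) (sym (side (to a∈T) (to c∈T) a≢c))
  where
  to : ∀ {x} → x ∈T (a , b , c) → x ∈T (a′ , b′ , c′)
  to {x} = Equivalence.to (T∼T′ x)
  from : ∀ {x} → x ∈T (a′ , b′ , c′) → x ∈T (a , b , c)
  from {x} = Equivalence.from (T∼T′ x)
  a∈T : a ∈T (a , b , c)
  a∈T = inj₁ refl
  b∈T : b ∈T (a , b , c)
  b∈T = inj₂ (inj₁ refl)
  c∈T : c ∈T (a , b , c)
  c∈T = inj₂ (inj₂ refl)
  a≢b : ¬ a ≡ b
  a≢b a≡b = pigeonhole a′≢b′ b′≢c′ a′≢c′ (merge₁₂ a≡b ∘ from)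
  b≢c : ¬ b ≡ c
  b≢c b≡c = pigeonhole a′≢b′ b′≢c′ a′≢c′ (merge₂₃ b≡c ∘ from)
  a≢c : ¬ a ≡ c
  a≢c a≡c = pigeonhole a′≢b′ b′≢c′ a′≢c′ (merge₁₃ a≡c ∘ from)
  a′c′≡a′b′ : dist² a′ c′ ≡ dist² a′ b′
  a′c′≡a′b′ = sym (trans a′b′≡b′c′ b′c′≡a′c′)
  side : ∀ {x y} → x ∈T (a′ , b′ , c′) → y ∈T (a′ , b′ , c′) → ¬ x ≡ y → dist² x y ≡ dist² a′ b′
  side (inj₁ refl)        (inj₁ refl)        x≢y = ⊥-elim (x≢y refl)
  side (inj₁ refl)        (inj₂ (inj₁ refl)) _   = refl
  side (inj₁ refl)        (inj₂ (inj₂ refl)) _   = a′c′≡a′b′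
  side (inj₂ (inj₁ refl)) (inj₁ refl)        _   = dist²-sym b′ a′
  side (inj₂ (inj₁ refl)) (inj₂ (inj₁ refl)) x≢y = ⊥-elim (x≢y refl)
  side (inj₂ (inj₁ refl)) (inj₂ (inj₂ refl)) _   = sym a′b′≡b′c′
  side (inj₂ (inj₂ refl)) (inj₁ refl)        _   = trans (dist²-sym c′ a′) a′c′≡a′b′
  side (inj₂ (inj₂ refl)) (inj₂ (inj₁ refl)) _   = trans (dist²-sym c′ b′) (sym a′b′≡b′c′)
  side (inj₂ (inj₂ refl)) (inj₂ (inj₂ refl)) x≢y = ⊥-elim (x≢y refl)

Admissible-resp : ∀ {T T′} → SameTriangle T T′ → Admissible T′ → Admissible T
Admissible-resp T∼T′ (equilateral , O∈T′ , inPlane) =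
  Equilateral-resp T∼T′ equilateral ,
  Equivalence.from (T∼T′ O) O∈T′ ,
  λ x x∈T → inPlane x (Equivalence.to (T∼T′ x) x∈T)

planeα : ℤ → ℤ → ℤ
planeα β γ = - (+ 11 * β) - + 11 * γ
{-# INLINE planeα #-}

planePoint : ℤ → ℤ → Point
planePoint β γ = (planeα β γ , β , γ)

planeNorm² : ℤ → ℤ → ℤ
planeNorm² β γ = planeα β γ * planeα β γ + β * β + γ * γ
{-# INLINE planeNorm² #-}

planePoint-InPlane : ∀ β γ → InPlane (planePoint β γ)
planePoint-InPlane β γ = begin
  planeα β γ + + 11 * β + + 11 * γ ≡⟨ solve (β ∷ γ ∷ []) ⟩
  + 0                              ∎

InPlane⇒≡planeα : ∀ {α β γ} → InPlane (α , β , γ) → α ≡ planeα β γ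
InPlane⇒≡planeα {α} {β} {γ} inPlane = begin
  α                                            ≡⟨ solve (α ∷ β ∷ γ ∷ []) ⟩
  (α + + 11 * β + + 11 * γ) + planeα β γ       ≡⟨ cong (_+ planeα β γ) inPlane ⟩
  + 0 + planeα β γ                             ≡⟨ +-identityˡ (planeα β γ) ⟩
  planeα β γ                                   ∎

≡planePoint : ∀ {α β γ} → α ≡ planeα β γ → (α , β , γ) ≡ planePoint β γ
≡planePoint refl = refl

dist²-planePoint : ∀ β γ β′ γ′ →
  dist² (planePoint β γ) (planePoint β′ γ′) ≡ planeNorm² (β - β′) (γ - γ′)
dist²-planePoint β γ β′ γ′ = begin
  dist² (planePoint β γ) (planePoint β′ γ′)
    ≡⟨⟩
  (planeα β γ - planeα β′ γ′) * (planeα β γ - planeα β′ γ′) + (β - β′) * (β - β′) + (γ - γ′) * (γ - γ′)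
    ≡⟨ solve (β ∷ γ ∷ β′ ∷ γ′ ∷ []) ⟩
  planeNorm² (β - β′) (γ - γ′) ∎

dist²-O-planePoint : ∀ β γ → dist² O (planePoint β γ) ≡ planeNorm² (0ℤ - β) (0ℤ - γ)
dist²-O-planePoint = dist²-planePoint 0ℤ 0ℤ

vA-planeCoordinates : ∀ m n → vA m n ≡ planePoint (+ 4 * m + + 5 * n) (- (+ 5 * m) - + 4 * n)
vA-planeCoordinates m n = ≡planePoint (solve (m ∷ n ∷ []))

vB-planeCoordinates : ∀ m n → vB m n ≡ planePoint (+ 9 * m - + 4 * n) (- (+ 9 * m) + + 5 * n)
vB-planeCoordinates m n = ≡planePoint (solve (m ∷ n ∷ []))

Parametrised : Triangle → Set
Parametrised T = ∃₂ λ m n → ¬ (m , n) ≡ (0ℤ , 0ℤ) × SameTriangle T (paramTriangle m n)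

Parametrised-resp : ∀ {T T′} → SameTriangle T T′ → Parametrised T′ → Parametrised T
Parametrised-resp T∼T′ (m , n , mn≢0 , T′∼P) = m , n , mn≢0 , SameTriangle-trans T∼T′ T′∼P

side-lengths : ∀ m n → let s = + 162 * hexNorm m n in
  dist² O (vA m n) ≡ s × dist² O (vB m n) ≡ s × dist² (vA m n) (vB m n) ≡ s
side-lengths m n =
  let βA = + 4 * m + + 5 * n ; γA = - (+ 5 * m) - + 4 * n
      βB = + 9 * m - + 4 * n ; γB = - (+ 9 * m) + + 5 * n
      A≡ = vA-planeCoordinates m n ; B≡ = vB-planeCoordinates m n
  in trans (cong (dist² O) A≡) (trans (dist²-O-planePoint βA γA) (solve (m ∷ n ∷ []))) ,
     trans (cong (dist² O) B≡) (trans (dist²-O-planePoint βB γB) (solve (m ∷ n ∷ []))) ,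
     trans (cong₂ dist² A≡ B≡) (trans (dist²-planePoint βA γA βB γB) (solve (m ∷ n ∷ [])))

params≢0 : ∀ {m n} → ¬ O ≡ vA m n ⊎ ¬ O ≡ vB m n → ¬ (m , n) ≡ (0ℤ , 0ℤ)
params≢0 (inj₁ O≢A) refl = O≢A refl
params≢0 (inj₂ O≢B) refl = O≢B refl

paramTriangle-admissible : ∀ {m n} → ¬ (m , n) ≡ (0ℤ , 0ℤ) → Admissible (paramTriangle m n)
paramTriangle-admissible {m} {n} mn≢0 =
  ( dist²≢0⇒≢ (s≢0 ∘ trans (sym OA)) , dist²≢0⇒≢ (s≢0 ∘ trans (sym AB)) , dist²≢0⇒≢ (s≢0 ∘ trans (sym OB))
  , trans OA (sym AB) , trans AB (sym OB)) ,
  inj₁ refl ,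
  inPlane
  where
  s≢0 : ¬ + 162 * hexNorm m n ≡ 0ℤ
  s≢0 s≡0 with hexNorm≡0⇒≡0 m n (*-cancelˡ-≡ (+ 162) (hexNorm m n) 0ℤ s≡0)
  ... | refl , refl = mn≢0 refl
  OA : dist² O (vA m n) ≡ + 162 * hexNorm m n
  OA = proj₁ (side-lengths m n)
  OB : dist² O (vB m n) ≡ + 162 * hexNorm m n
  OB = proj₁ (proj₂ (side-lengths m n))
  AB : dist² (vA m n) (vB m n) ≡ + 162 * hexNorm m n
  AB = proj₂ (proj₂ (side-lengths m n))
  inPlane : ∀ x → x ∈T paramTriangle m n → ¬ x ≡ O → InPlane x
  inPlane x (inj₁ refl)         x≢O = ⊥-elim (x≢O refl)
  inPlane x (inj₂ (inj₁ refl))  _   =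
    subst InPlane (sym (vA-planeCoordinates m n)) (planePoint-InPlane (+ 4 * m + + 5 * n) (- (+ 5 * m) - + 4 * n))
  inPlane x (inj₂ (inj₂ refl))  _   =
    subst InPlane (sym (vB-planeCoordinates m n)) (planePoint-InPlane (+ 9 * m - + 4 * n) (- (+ 9 * m) + + 5 * n))

spread : ℤ → ℤ → ℤ → ℤ
spread d₀ d₁ d₂ = (d₀ - d₁) * (d₀ - d₁) + (d₁ - d₂) * (d₁ - d₂) + (d₂ - d₀) * (d₂ - d₀)
{-# INLINE spread #-}

spread-cong : ∀ {d₀ d₁ d₂ e₀ e₁ e₂} → d₀ ≡ e₀ → d₁ ≡ e₁ → d₂ ≡ e₂ → spread d₀ d₁ d₂ ≡ spread e₀ e₁ e₂
spread-cong refl refl refl = refl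

spread-self : ∀ d → spread d d d ≡ 0ℤ
spread-self = solve-∀

-- For u = planePoint β γ and v = planePoint β′ γ′ the rotation defect (18 v − 9 u − N × u) / 2
-- is turn₁ · vA 0 1 − turn₂ · vB 1 0, of squared length 162 · hexNorm turn₁ turn₂.

turn₁ turn₂ : ℤ → ℤ → ℤ → ℤ → ℤ
turn₁ β γ β′ γ′ = + 9 * (β′ + γ′) - + 5 * β - + 4 * γ
turn₂ β γ β′ γ′ = + 4 * β′ + + 5 * γ′ - + 9 * (β + γ)
{-# INLINE turn₁ #-}
{-# INLINE turn₂ #-}

Rotated : ℤ → ℤ → ℤ → ℤ → Set
Rotated β γ β′ γ′ = turn₁ β γ β′ γ′ ≡ 0ℤ × turn₂ β γ β′ γ′ ≡ 0ℤ

turn-identity : ∀ β γ β′ γ′ → let u = planePoint β γ ; v = planePoint β′ γ′ in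
  + 8 * (hexNorm (turn₁ β γ β′ γ′) (turn₂ β γ β′ γ′) * hexNorm (turn₁ β′ γ′ β γ) (turn₂ β′ γ′ β γ))
    ≡ spread (dist² O u) (dist² O v) (dist² u v)
turn-identity β γ β′ γ′ = sym (begin
  spread (dist² O (planePoint β γ)) (dist² O (planePoint β′ γ′)) (dist² (planePoint β γ) (planePoint β′ γ′))
    ≡⟨ spread-cong (dist²-O-planePoint β γ) (dist²-O-planePoint β′ γ′) (dist²-planePoint β γ β′ γ′) ⟩
  spread (planeNorm² (0ℤ - β) (0ℤ - γ)) (planeNorm² (0ℤ - β′) (0ℤ - γ′)) (planeNorm² (β - β′) (γ - γ′))
    ≡⟨ solve (β ∷ γ ∷ β′ ∷ γ′ ∷ []) ⟩
  _ ∎)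

turn-vanishes : ∀ β γ β′ γ′ → let u = planePoint β γ ; v = planePoint β′ γ′ in
  dist² O u ≡ dist² u v → dist² u v ≡ dist² O v → Rotated β γ β′ γ′ ⊎ Rotated β′ γ′ β γ
turn-vanishes β γ β′ γ′ Ou≡uv uv≡Ov =
  Sum.map (hexNorm≡0⇒≡0 σ τ) (hexNorm≡0⇒≡0 σ′ τ′) (i*j≡0⇒i≡0∨j≡0 (hexNorm σ τ)
    (*-cancelˡ-≡ (+ 8) (hexNorm σ τ * hexNorm σ′ τ′) 0ℤ (begin
      + 8 * (hexNorm σ τ * hexNorm σ′ τ′)           ≡⟨ turn-identity β γ β′ γ′ ⟩
      spread (dist² O u) (dist² O v) (dist² u v)    ≡⟨ spread-cong Ou≡uv (sym uv≡Ov) refl ⟩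
      spread (dist² u v) (dist² u v) (dist² u v)    ≡⟨ spread-self (dist² u v) ⟩
      0ℤ                                            ∎)))
  where
  u v : Point
  u = planePoint β γ
  v = planePoint β′ γ′
  σ τ σ′ τ′ : ℤ
  σ  = turn₁ β γ β′ γ′
  τ  = turn₂ β γ β′ γ′
  σ′ = turn₁ β′ γ′ β γ
  τ′ = turn₂ β′ γ′ β γ

-- m and n are read off from the coordinate sums β + γ = n − m of vA m n and β′ + γ′ = n of vB m n.

vA-turn : ∀ β γ β′ γ′ → let m = β′ + γ′ - (β + γ) ; n = β′ + γ′ in
  vA m n ≡ planePoint (β + turn₁ β γ β′ γ′) (γ - turn₁ β γ β′ γ′)
vA-turn β γ β′ γ′ = cong₂ _,_ (solve vars) (cong₂ _,_ (solve vars) (solve vars))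
  where
  vars : List ℤ
  vars = β ∷ γ ∷ β′ ∷ γ′ ∷ []

vB-turn : ∀ β γ β′ γ′ → let m = β′ + γ′ - (β + γ) ; n = β′ + γ′ in
  vB m n ≡ planePoint (β′ + turn₂ β γ β′ γ′) (γ′ - turn₂ β γ β′ γ′)
vB-turn β γ β′ γ′ = cong₂ _,_ (solve vars) (cong₂ _,_ (solve vars) (solve vars))
  where
  vars : List ℤ
  vars = β ∷ γ ∷ β′ ∷ γ′ ∷ []

planePoint-shear : ∀ {β γ d} → d ≡ 0ℤ → planePoint (β + d) (γ - d) ≡ planePoint β γ
planePoint-shear {β} {γ} refl = cong₂ planePoint (+-identityʳ β) (+-identityʳ γ)

Rotated⇒params : ∀ β γ β′ γ′ → Rotated β γ β′ γ′ → let m = β′ + γ′ - (β + γ) ; n = β′ + γ′ in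
  planePoint β γ ≡ vA m n × planePoint β′ γ′ ≡ vB m n
Rotated⇒params β γ β′ γ′ (turn₁≡0 , turn₂≡0) =
  sym (trans (vA-turn β γ β′ γ′) (planePoint-shear turn₁≡0)) ,
  sym (trans (vB-turn β γ β′ γ′) (planePoint-shear turn₂≡0))

parametrised-apex : ∀ u v m n → ¬ O ≡ u →
  (u ≡ vA m n × v ≡ vB m n) ⊎ (u ≡ vB m n × v ≡ vA m n) → Parametrised (O , u , v)
parametrised-apex _ _ m n O≢u (inj₁ (refl , refl)) = m , n , params≢0 (inj₁ O≢u) , SameTriangle-refl
parametrised-apex _ _ m n O≢u (inj₂ (refl , refl)) = m , n , params≢0 (inj₂ O≢u) , SameTriangle-swap₂₃

planePoint-apex : ∀ β γ β′ γ′ → Admissible (O , planePoint β γ , planePoint β′ γ′) →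
  Parametrised (O , planePoint β γ , planePoint β′ γ′)
planePoint-apex β γ β′ γ′ ((O≢u , _ , _ , Ou≡uv , uv≡Ov) , _) =
  [ forwards , backwards ]′ (turn-vanishes β γ β′ γ′ Ou≡uv uv≡Ov)
  where
  u v : Point
  u = planePoint β γ
  v = planePoint β′ γ′
  forwards : Rotated β γ β′ γ′ → Parametrised (O , u , v)
  forwards rotated =
    parametrised-apex u v (β′ + γ′ - (β + γ)) (β′ + γ′) O≢u (inj₁ (Rotated⇒params β γ β′ γ′ rotated))
  backwards : Rotated β′ γ′ β γ → Parametrised (O , u , v)
  backwards rotated =
    parametrised-apex u v (β + γ - (β′ + γ′)) (β + γ) O≢u (inj₂ (swap (Rotated⇒params β′ γ′ β γ rotated)))

apex-parametrised : ∀ {u v} → Admissible (O , u , v) → Parametrised (O , u , v)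
apex-parametrised {α , β , γ} {α′ , β′ , γ′} admissible@((O≢u , _ , O≢v , _) , _ , inPlane) =
  subst₂ (λ u v → Parametrised (O , u , v)) (sym u≡) (sym v≡)
    (planePoint-apex β γ β′ γ′ (subst₂ (λ u v → Admissible (O , u , v)) u≡ v≡ admissible))
  where
  u≡ : (α , β , γ) ≡ planePoint β γ
  u≡ = ≡planePoint (InPlane⇒≡planeα {α} {β} {γ} (inPlane _ (inj₂ (inj₁ refl)) (O≢u ∘ sym)))
  v≡ : (α′ , β′ , γ′) ≡ planePoint β′ γ′
  v≡ = ≡planePoint (InPlane⇒≡planeα {α′} {β′} {γ′} (inPlane _ (inj₂ (inj₂ refl)) (O≢v ∘ sym)))

admissible⇒parametrised : ∀ {T} → Admissible T → Parametrised T
admissible⇒parametrised admissible@(_ , O∈T , _) =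
  let u , v , T∼Ouv = ∈T⇒first O∈T
  in Parametrised-resp T∼Ouv (apex-parametrised (Admissible-resp (SameTriangle-sym T∼Ouv) admissible))

parametrised⇒admissible : ∀ {T} → Parametrised T → Admissible T
parametrised⇒admissible (m , n , mn≢0 , T∼P) = Admissible-resp T∼P (paramTriangle-admissible mn≢0)

mainTheorem11 :
    (∀ (T : Triangle) →
      Admissible T ⇔ ∃₂ (λ m n → ¬ (m , n) ≡ (+ 0 , + 0) × SameTriangle T (paramTriangle m n)))
    × (∀ (m n : ℤ) →
      let s = + 162 * (m * m - m * n + n * n) in
      dist² O (vA m n) ≡ s × dist² O (vB m n) ≡ s × dist² (vA m n) (vB m n) ≡ s)
mainTheorem11 = (λ T → mk⇔ admissible⇒parametrised parametrised⇒admissible) , side-lengths
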